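{- The chromatic number of $Q_8^2$ equals $13$.
   Context: $Q_n$ denotes the $n$-dimensional hypercube: the graph whose vertices are the binary words of length $n$ (elements of $\mathbb{Z}_2^n$), with two vertices adjacent exactly when the Hamming distance between them is $1$. For a graph $\Gamma$, its $k$th power $\Gamma^k$ has the same vertex set, and two distinct vertices are adjacent exactly when their distance in $\Gamma$ is at most $k$. Thus $Q_8^2$ has vertex set $\mathbb{Z}_2^8$, and two distinct words are adjacent exactly when their Hamming distance is at most $2$. -}

module Defs where

open import Data.Nat using (ℕ; zero; suc; _+_; _≤_)
open import Data.Bool using (Bool; true; false)
open import Data.Fin using (Fin)
open import Data.Vec using (Vec; []; _∷_)
open import Data.Product using (Σ; _×_)
open import Relation.Binary.PropositionalEquality using (_≡_)
open import Relation.Nullary using (¬_)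

record Graph : Set₁ where
  field
    V   : Set
    Adj : V → V → Set

ProperColouring : (G : Graph) → (k : ℕ) → (Graph.V G → Fin k) → Set
ProperColouring G k c = ∀ u v → Graph.Adj G u v → ¬ (c u ≡ c v)

Colourable : Graph → ℕ → Set
Colourable G k = Σ (Graph.V G → Fin k) (ProperColouring G k)

ChromaticNumberIs : Graph → ℕ → Set
ChromaticNumberIs G k = Colourable G k × (∀ m → suc m ≤ k → ¬ Colourable G m)

hamming : ∀ {n} → Vec Bool n → Vec Bool n → ℕ
hamming [] [] = 0
hamming (true ∷ xs) (true ∷ ys) = hamming xs ys
hamming (false ∷ xs) (false ∷ ys) = hamming xs ys
hamming (true ∷ xs) (false ∷ ys) = suc (hamming xs ys)
hamming (false ∷ xs) (true ∷ ys) = suc (hamming xs ys)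

-- Q_n^k : vertices Z_2^n, distinct words adjacent iff Hamming distance ≤ k
-- (distance in Q_n equals Hamming distance).
cubePower : ℕ → ℕ → Graph
cubePower n k = record
  { V   = Vec Bool n
  ; Adj = λ u v → ¬ (u ≡ v) × (hamming u v ≤ k)
  }

module Submission where

open import Algebra.Bundles using (CommutativeRing)
import Algebra.Properties.CommutativeSemigroup as CommutativeSemigroupProperties
open import Data.Bool using (Bool; true; false; _∧_; _xor_; if_then_else_)
open import Data.Bool.Properties using (xor-∧-commutativeRing; ∧-distribˡ-xor) renaming (_≟_ to _≟ᵇ_)
open import Data.Empty using (⊥-elim)
open import Data.Fin as Fin using (Fin; #_; combine)
open import Data.Fin.Properties using (_≟_)
open import Data.Integer as ℤ using (ℤ; +_; -[1+_]; _+_; _*_; _≤_; +≤+)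
import Data.Integer.Properties as ℤₚ
open import Data.List using (List; []; _∷_; _++_; map; filter; length; allFin)
open import Data.List.Membership.Propositional using (_∈_)
open import Data.List.Membership.Propositional.Properties
  using (∈-map⁺; ∈-map⁻; ∈-++⁺ˡ; ∈-++⁺ʳ; ∈-filter⁻; ∈-allFin)
open import Data.List.Properties using (length-tabulate)
open import Data.List.Relation.Unary.Any using (here; there)
import Data.List.Relation.Unary.All as All
open import Data.List.Relation.Unary.AllPairs using ([]; _∷_)
open import Data.List.Relation.Unary.Unique.Propositional using (Unique)
import Data.List.Relation.Unary.Unique.Propositional.Properties as Unique
open import Data.Nat as ℕ using (ℕ; zero; suc; z≤n; s≤s; _^_)
import Data.Nat.Properties as ℕₚ
open import Data.List.Membership.DecPropositional ℕₚ._≟_ using (_∈?_)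
open import Data.Product using (_×_; _,_; proj₂)
open import Data.Sum using (_⊎_; inj₁; inj₂)
open import Data.Vec using (Vec; []; _∷_; replicate; zipWith; lookup)
open import Data.Vec.Properties using (∷-injectiveʳ; ≡-dec)
open import Function using (_∘_)
open import Relation.Nullary using (Dec; yes; no; does; ¬_)
open import Relation.Nullary.Decidable using (map′; from-yes; _⊎-dec_; _→-dec_; ¬?; _×-dec_)
open import Relation.Binary.PropositionalEquality

open import Defs

-- A colour class of Q₈² is a binary code of length 8 and minimum distance 3. Delsarte's
-- linear programming bound caps such codes at 21 words: the character sum
-- F(z) = Σ (-1)^(u·z) over the words u of weight 1, 2, 7 or 8 is positive definite, so
-- 3|C|² ≤ Σ_{x,y ∈ C} (F(x+y) + 3); and F + 3 is at most 48 at weight 0, at most 16 at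
-- weights 7 and 8 (each codeword has at most one such partner in C, by the triangle
-- inequality) and nonpositive at weights 3 to 6, so every row of that double sum is at
-- most 64. Twelve colours therefore cover at most 252 < 256 words, while an explicit
-- 13-colouring, checked exhaustively, gives the upper bound.

Word : ℕ → Set
Word = Vec Bool

words : ∀ n → List (Word n)
words zero    = [] ∷ []
words (suc n) = map (true ∷_) (words n) ++ map (false ∷_) (words n)

∈-words : ∀ {n} (w : Word n) → w ∈ words n
∈-words []          = here refl
∈-words (true ∷ w)  = ∈-++⁺ˡ (∈-map⁺ (true ∷_) (∈-words w))
∈-words (false ∷ w) = ∈-++⁺ʳ _ (∈-map⁺ (false ∷_) (∈-words w))

words-unique : ∀ n → Unique (words n)
words-unique zero    = All.[] ∷ []
words-unique (suc n) =
  Unique.++⁺ (Unique.map⁺ ∷-injectiveʳ (words-unique n)) (Unique.map⁺ ∷-injectiveʳ (words-unique n)) disjoint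
  where
  disjoint : ∀ {w} → ¬ (w ∈ map (true ∷_) (words n) × w ∈ map (false ∷_) (words n))
  disjoint (t , f) with ∈-map⁻ (true ∷_) t | ∈-map⁻ (false ∷_) f
  ... | _ , _ , refl | _ , _ , ()

all-words? : ∀ {n} {P : Word n → Set} → (∀ w → Dec (P w)) → Dec (∀ w → P w)
all-words? P? = map′ (λ all w → All.lookup all (∈-words w)) (λ ∀P → All.tabulate (λ {w} _ → ∀P w))
                     (All.all? P? (words _))

_≟ʷ_ : ∀ {n} (x y : Word n) → Dec (x ≡ y)
_≟ʷ_ = ≡-dec _≟ᵇ_

infixl 6 _⊕_
_⊕_ : ∀ {n} → Word n → Word n → Word n
_⊕_ = zipWith _xor_

weight : ∀ {n} → Word n → ℕ
weight w = hamming w (replicate _ false)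

hamming≡weight-⊕ : ∀ {n} (x y : Word n) → hamming x y ≡ weight (x ⊕ y)
hamming≡weight-⊕ []          []          = refl
hamming≡weight-⊕ (true ∷ x)  (true ∷ y)  = hamming≡weight-⊕ x y
hamming≡weight-⊕ (true ∷ x)  (false ∷ y) = cong suc (hamming≡weight-⊕ x y)
hamming≡weight-⊕ (false ∷ x) (true ∷ y)  = cong suc (hamming≡weight-⊕ x y)
hamming≡weight-⊕ (false ∷ x) (false ∷ y) = hamming≡weight-⊕ x y

hamming-self : ∀ {n} (x : Word n) → hamming x x ≡ 0
hamming-self []          = refl
hamming-self (true ∷ x)  = hamming-self x
hamming-self (false ∷ x) = hamming-self x

hamming≡0⇒≡ : ∀ {n} {x y : Word n} → hamming x y ≡ 0 → x ≡ y
hamming≡0⇒≡ {x = []}         {[]}         _ = refl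
hamming≡0⇒≡ {x = true ∷ x}   {true ∷ y}   d = cong (true ∷_) (hamming≡0⇒≡ d)
hamming≡0⇒≡ {x = false ∷ x}  {false ∷ y}  d = cong (false ∷_) (hamming≡0⇒≡ d)
hamming≡0⇒≡ {x = true ∷ _}   {false ∷ _}  ()
hamming≡0⇒≡ {x = false ∷ _}  {true ∷ _}   ()

hamming-perimeter : ∀ {n} (x y z : Word n) → hamming x y ℕ.+ hamming x z ℕ.+ hamming y z ℕ.≤ n ℕ.+ n
hamming-perimeter []       []       []       = z≤n
hamming-perimeter {suc n} (a ∷ x) (b ∷ y) (c ∷ z) = step a b c
  where
  p q r : ℕ
  p = hamming x y
  q = hamming x z
  r = hamming y z

  allAgree : p ℕ.+ q ℕ.+ r ℕ.≤ suc n ℕ.+ suc n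
  allAgree = ℕₚ.≤-trans (hamming-perimeter x y z) (ℕₚ.+-mono-≤ (ℕₚ.n≤1+n n) (ℕₚ.n≤1+n n))

  twoGrow : ∀ {s} → s ≡ 2 ℕ.+ (p ℕ.+ q ℕ.+ r) → s ℕ.≤ suc n ℕ.+ suc n
  twoGrow refl = subst (2 ℕ.+ (p ℕ.+ q ℕ.+ r) ℕ.≤_) (cong suc (sym (ℕₚ.+-suc n n)))
                       (s≤s (s≤s (hamming-perimeter x y z)))

  onlyZDiffers : p ℕ.+ suc q ℕ.+ suc r ≡ 2 ℕ.+ (p ℕ.+ q ℕ.+ r)
  onlyZDiffers = trans (ℕₚ.+-suc (p ℕ.+ suc q) r) (cong (λ t → suc (t ℕ.+ r)) (ℕₚ.+-suc p q))

  onlyYDiffers : suc p ℕ.+ q ℕ.+ suc r ≡ 2 ℕ.+ (p ℕ.+ q ℕ.+ r)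
  onlyYDiffers = ℕₚ.+-suc (suc p ℕ.+ q) r

  onlyXDiffers : suc p ℕ.+ suc q ℕ.+ r ≡ 2 ℕ.+ (p ℕ.+ q ℕ.+ r)
  onlyXDiffers = cong (λ t → suc (t ℕ.+ r)) (ℕₚ.+-suc p q)

  step : ∀ a b c → hamming (a ∷ x) (b ∷ y) ℕ.+ hamming (a ∷ x) (c ∷ z) ℕ.+ hamming (b ∷ y) (c ∷ z)
                     ℕ.≤ suc n ℕ.+ suc n
  step true  true  true  = allAgree
  step false false false = allAgree
  step true  true  false = twoGrow onlyZDiffers
  step false false true  = twoGrow onlyZDiffers
  step true  false true  = twoGrow onlyYDiffers
  step false true  false = twoGrow onlyYDiffers
  step true  false false = twoGrow onlyXDiffers
  step false true  true  = twoGrow onlyXDiffers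

infixl 7 _·_
_·_ : ∀ {n} → Word n → Word n → Bool
[]       · []       = false
(u ∷ us) · (x ∷ xs) = (u ∧ x) xor (us · xs)

open CommutativeSemigroupProperties (CommutativeRing.+-commutativeSemigroup xor-∧-commutativeRing)
  using () renaming (interchange to xor-interchange)

·-distribˡ-⊕ : ∀ {n} (u x y : Word n) → u · (x ⊕ y) ≡ (u · x) xor (u · y)
·-distribˡ-⊕ []       []      []      = refl
·-distribˡ-⊕ (u ∷ us) (a ∷ x) (b ∷ y) = begin
  (u ∧ (a xor b)) xor us · (x ⊕ y)                  ≡⟨ cong₂ _xor_ (∧-distribˡ-xor u a b) (·-distribˡ-⊕ us x y) ⟩
  ((u ∧ a) xor (u ∧ b)) xor (us · x xor us · y)     ≡⟨ xor-interchange (u ∧ a) (u ∧ b) (us · x) (us · y) ⟩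
  ((u ∧ a) xor us · x) xor ((u ∧ b) xor us · y)     ∎
  where open ≡-Reasoning

sign : Bool → ℤ
sign false = + 1
sign true  = -[1+ 0 ]

sign-xor : ∀ a b → sign (a xor b) ≡ sign a * sign b
sign-xor false false = refl
sign-xor false true  = refl
sign-xor true  false = refl
sign-xor true  true  = refl

χ : ∀ {n} → Word n → Word n → ℤ
χ u x = sign (u · x)

χ-⊕ : ∀ {n} (u x y : Word n) → χ u (x ⊕ y) ≡ χ u x * χ u y
χ-⊕ u x y = trans (cong sign (·-distribˡ-⊕ u x y)) (sign-xor (u · x) (u · y))

square-nonneg : ∀ i → + 0 ≤ i * i
square-nonneg (+ n)    = subst (+ 0 ≤_) (ℤₚ.pos-* n n) (+≤+ z≤n)
square-nonneg -[1+ n ] = +≤+ z≤n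

∑ : {A : Set} → List A → (A → ℤ) → ℤ
∑ []       f = + 0
∑ (a ∷ as) f = f a + ∑ as f

infix 5 ∑
syntax ∑ L (λ x → e) = ∑[ x ← L ] e

module _ {A : Set} where

  ∑-cong : ∀ (L : List A) {f g : A → ℤ} → (∀ a → f a ≡ g a) → ∑ L f ≡ ∑ L g
  ∑-cong []      f≡g = refl
  ∑-cong (a ∷ L) f≡g = cong₂ _+_ (f≡g a) (∑-cong L f≡g)

  ∑-+ : ∀ (L : List A) (f g : A → ℤ) → ∑[ a ← L ] (f a + g a) ≡ ∑ L f + ∑ L g
  ∑-+ []      f g = refl
  ∑-+ (a ∷ L) f g = trans (cong (_+_ (f a + g a)) (∑-+ L f g))
                          (ℤ-interchange (f a) (g a) (∑ L f) (∑ L g))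
    where open CommutativeSemigroupProperties ℤₚ.+-commutativeSemigroup renaming (interchange to ℤ-interchange)

  ∑-*ˡ : ∀ (L : List A) (c : ℤ) (f : A → ℤ) → ∑[ a ← L ] (c * f a) ≡ c * ∑ L f
  ∑-*ˡ []      c f = sym (ℤₚ.*-zeroʳ c)
  ∑-*ˡ (a ∷ L) c f = trans (cong (_+_ (c * f a)) (∑-*ˡ L c f)) (sym (ℤₚ.*-distribˡ-+ c (f a) (∑ L f)))

  ∑-*ʳ : ∀ (L : List A) (c : ℤ) (f : A → ℤ) → ∑[ a ← L ] (f a * c) ≡ ∑ L f * c
  ∑-*ʳ L c f = trans (∑-cong L (λ a → ℤₚ.*-comm (f a) c)) (trans (∑-*ˡ L c f) (ℤₚ.*-comm c (∑ L f)))

  ∑-const : ∀ (L : List A) (k : ℕ) → ∑[ _ ← L ] + k ≡ + (length L ℕ.* k)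
  ∑-const []      k = refl
  ∑-const (a ∷ L) k = cong (_+_ (+ k)) (∑-const L k)

  ∑-mono-≤ : ∀ (L : List A) {f g : A → ℤ} → (∀ {a} → a ∈ L → f a ≤ g a) → ∑ L f ≤ ∑ L g
  ∑-mono-≤ []      f≤g = ℤₚ.≤-refl
  ∑-mono-≤ (a ∷ L) f≤g = ℤₚ.+-mono-≤ (f≤g (here refl)) (∑-mono-≤ L (f≤g ∘ there))

  ∑-nonneg : ∀ (L : List A) {f : A → ℤ} → (∀ a → + 0 ≤ f a) → + 0 ≤ ∑ L f
  ∑-nonneg []      0≤f = ℤₚ.≤-refl
  ∑-nonneg (a ∷ L) 0≤f = ℤₚ.+-mono-≤ (0≤f a) (∑-nonneg L 0≤f)

∑-swap : {A B : Set} (L : List A) (K : List B) (f : A → B → ℤ) →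
         ∑[ a ← L ] ∑[ b ← K ] f a b ≡ ∑[ b ← K ] ∑[ a ← L ] f a b
∑-swap []      K f = sym (trans (∑-const K 0) (cong +_ (ℕₚ.*-zeroʳ (length K))))
∑-swap (a ∷ L) K f = trans (cong (_+_ (∑ K (f a))) (∑-swap L K f))
                           (sym (∑-+ K (f a) (λ b → ∑[ a′ ← L ] f a′ b)))

𝟙 : {P : Set} → Dec P → ℤ
𝟙 P? = if does P? then + 1 else + 0

module _ {A : Set} {P : A → Set} (P? : ∀ a → Dec (P a)) where

  𝟙-nonneg : ∀ a → + 0 ≤ 𝟙 (P? a)
  𝟙-nonneg a with does (P? a)
  ... | true  = +≤+ z≤n
  ... | false = +≤+ z≤n

  ∑-𝟙≡length-filter : ∀ (L : List A) → ∑[ a ← L ] 𝟙 (P? a) ≡ + length (filter P? L)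
  ∑-𝟙≡length-filter []      = refl
  ∑-𝟙≡length-filter (a ∷ L) with does (P? a)
  ... | true  = cong (_+_ (+ 1)) (∑-𝟙≡length-filter L)
  ... | false = trans (ℤₚ.+-identityˡ _) (∑-𝟙≡length-filter L)

  ∑-𝟙≡0 : ∀ (L : List A) → (∀ {a} → a ∈ L → ¬ P a) → ∑[ a ← L ] 𝟙 (P? a) ≡ + 0
  ∑-𝟙≡0 []      none = refl
  ∑-𝟙≡0 (a ∷ L) none with P? a
  ... | yes Pa = ⊥-elim (none (here refl) Pa)
  ... | no  _  = trans (ℤₚ.+-identityˡ _) (∑-𝟙≡0 L (none ∘ there))

  ∑-𝟙≥1 : ∀ {L : List A} {a} → a ∈ L → P a → + 1 ≤ ∑[ b ← L ] 𝟙 (P? b)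
  ∑-𝟙≥1 {b ∷ L} (here refl) Pa with P? b
  ... | yes _  = ℤₚ.+-monoʳ-≤ (+ 1) (∑-nonneg L 𝟙-nonneg)
  ... | no ¬Pa = ⊥-elim (¬Pa Pa)
  ∑-𝟙≥1 {b ∷ L} (there a∈L) Pa = ℤₚ.+-mono-≤ (𝟙-nonneg b) (∑-𝟙≥1 a∈L Pa)

  ∑-𝟙≤1 : ∀ {L : List A} → Unique L → (∀ {a b} → a ∈ L → b ∈ L → P a → P b → a ≡ b) →
          ∑[ a ← L ] 𝟙 (P? a) ≤ + 1
  ∑-𝟙≤1 {[]}    _              _      = +≤+ z≤n
  ∑-𝟙≤1 {a ∷ L} (a∉L ∷ unique) atMost with P? a
  ... | yes Pa = ℤₚ.≤-reflexive (cong (_+_ (+ 1)) (∑-𝟙≡0 L (λ b∈L Pb →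
                   All.lookup a∉L b∈L (atMost (here refl) (there b∈L) Pa Pb))))
  ... | no  _  = subst (_≤ + 1) (sym (ℤₚ.+-identityˡ _))
                         (∑-𝟙≤1 unique (λ a∈L b∈L → atMost (there a∈L) (there b∈L)))

characterSum : ∀ {n} → List (Word n) → Word n → ℤ
characterSum U z = ∑[ u ← U ] χ u z

characterSum-positiveDefinite : ∀ {n} (U C : List (Word n)) →
                                + 0 ≤ ∑[ x ← C ] ∑[ y ← C ] characterSum U (x ⊕ y)
characterSum-positiveDefinite {n} U C =
  subst (+ 0 ≤_) (sym sumOfSquares) (∑-nonneg U (λ u → square-nonneg (S u)))
  where
  S : Word n → ℤ
  S u = ∑[ x ← C ] χ u x

  open ≡-Reasoning
  sumOfSquares : ∑[ x ← C ] ∑[ y ← C ] characterSum U (x ⊕ y) ≡ ∑[ u ← U ] (S u * S u)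
  sumOfSquares = begin
    ∑[ x ← C ] ∑[ y ← C ] ∑[ u ← U ] χ u (x ⊕ y)
      ≡⟨ ∑-cong C (λ x → ∑-cong C (λ y → ∑-cong U (λ u → χ-⊕ u x y))) ⟩
    ∑[ x ← C ] ∑[ y ← C ] ∑[ u ← U ] (χ u x * χ u y)
      ≡⟨ ∑-cong C (λ x → ∑-swap C U (λ y u → χ u x * χ u y)) ⟩
    ∑[ x ← C ] ∑[ u ← U ] ∑[ y ← C ] (χ u x * χ u y)
      ≡⟨ ∑-swap C U (λ x u → ∑[ y ← C ] (χ u x * χ u y)) ⟩
    ∑[ u ← U ] ∑[ x ← C ] ∑[ y ← C ] (χ u x * χ u y)
      ≡⟨ ∑-cong U (λ u → ∑-cong C (λ x → ∑-*ˡ C (χ u x) (χ u))) ⟩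
    ∑[ u ← U ] ∑[ x ← C ] (χ u x * S u)
      ≡⟨ ∑-cong U (λ u → ∑-*ʳ C (S u) (χ u)) ⟩
    ∑[ u ← U ] (S u * S u) ∎

delsarte-bound : ∀ {n} (U C : List (Word n)) (c b : ℕ) →
                 (∀ {x} → x ∈ C → ∑[ y ← C ] (characterSum U (x ⊕ y) + + c) ≤ + b) →
                 length C ℕ.* c ℕ.≤ b
delsarte-bound {n} U C c b rowBound = cancel (length C) (ℤₚ.drop‿+≤+ (begin
  + (length C ℕ.* (length C ℕ.* c))               ≡⟨ sym doubleConst ⟩
  ∑[ x ← C ] ∑[ y ← C ] + c                        ≡⟨ sym (ℤₚ.+-identityˡ _) ⟩
  + 0 + (∑[ x ← C ] ∑[ y ← C ] + c)                ≤⟨ ℤₚ.+-monoˡ-≤ _ (characterSum-positiveDefinite U C) ⟩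
  (∑[ x ← C ] ∑[ y ← C ] F x y) + (∑[ x ← C ] ∑[ y ← C ] + c)
                                                   ≡⟨ sym splitSum ⟩
  ∑[ x ← C ] ∑[ y ← C ] (F x y + + c)             ≤⟨ ∑-mono-≤ C rowBound ⟩
  ∑[ x ← C ] + b                                   ≡⟨ ∑-const C b ⟩
  + (length C ℕ.* b)                               ∎))
  where
  open ℤₚ.≤-Reasoning
  F : Word n → Word n → ℤ
  F x y = characterSum U (x ⊕ y)

  doubleConst : ∑[ x ← C ] ∑[ y ← C ] + c ≡ + (length C ℕ.* (length C ℕ.* c))
  doubleConst = trans (∑-cong C (λ _ → ∑-const C c)) (∑-const C (length C ℕ.* c))

  splitSum : ∑[ x ← C ] ∑[ y ← C ] (F x y + + c)
             ≡ (∑[ x ← C ] ∑[ y ← C ] F x y) + (∑[ x ← C ] ∑[ y ← C ] + c)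
  splitSum = trans (∑-cong C (λ x → ∑-+ C (F x) (λ _ → + c)))
                   (∑-+ C (λ x → ∑ C (F x)) (λ _ → ∑[ y ← C ] + c))

  cancel : ∀ m → m ℕ.* (m ℕ.* c) ℕ.≤ m ℕ.* b → m ℕ.* c ℕ.≤ b
  cancel zero    _  = z≤n
  cancel (suc m) le = ℕₚ.*-cancelˡ-≤ (suc m) le

HasMinDistance : ∀ {n} → ℕ → List (Word n) → Set
HasMinDistance d C = ∀ {x y} → x ∈ C → y ∈ C → ¬ x ≡ y → d ℕ.≤ hamming x y

-- characterSum delsarteDual₈ depends only on the weight w of its argument: it is
-- K₁(w) + K₂(w) + K₇(w) + K₈(w) for the Krawtchouk polynomials of length 8.
delsarteDual₈ : List (Word 8)
delsarteDual₈ = filter (λ u → weight u ∈? (1 ∷ 2 ∷ 7 ∷ 8 ∷ [])) (words 8)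

delsarteDual₈-certificate : ∀ z → weight z ≡ 0 ⊎ 3 ℕ.≤ weight z →
  characterSum delsarteDual₈ z + + 3 ≤ + 48 * 𝟙 (weight z ℕ.≟ 0) + + 16 * 𝟙 (7 ℕ.≤? weight z)
delsarteDual₈-certificate = from-yes (all-words? λ z →
  (weight z ℕ.≟ 0 ⊎-dec 3 ℕ.≤? weight z) →-dec
  (characterSum delsarteDual₈ z + + 3 ℤ.≤? + 48 * 𝟙 (weight z ℕ.≟ 0) + + 16 * 𝟙 (7 ℕ.≤? weight z)))

row-bound₈ : ∀ {C : List (Word 8)} → Unique C → HasMinDistance 3 C →
             ∀ {x} → x ∈ C → ∑[ y ← C ] (characterSum delsarteDual₈ (x ⊕ y) + + 3) ≤ + 64
row-bound₈ {C} unique minDist {x} x∈C = begin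
  ∑[ y ← C ] (characterSum delsarteDual₈ (x ⊕ y) + + 3)
    ≤⟨ ∑-mono-≤ C pointwise ⟩
  ∑[ y ← C ] (+ 48 * 𝟙 (equal? y) + + 16 * 𝟙 (far? y))
    ≡⟨ trans (∑-+ C _ _) (cong₂ _+_ (∑-*ˡ C (+ 48) _) (∑-*ˡ C (+ 16) _)) ⟩
  + 48 * (∑[ y ← C ] 𝟙 (equal? y)) + + 16 * (∑[ y ← C ] 𝟙 (far? y))
    ≤⟨ ℤₚ.+-mono-≤ (ℤₚ.*-monoˡ-≤-nonNeg (+ 48) (∑-𝟙≤1 equal? unique atMostOneEqual))
                   (ℤₚ.*-monoˡ-≤-nonNeg (+ 16) (∑-𝟙≤1 far? unique atMostOneFar)) ⟩
  + 64 ∎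
  where
  open ℤₚ.≤-Reasoning

  equal? : ∀ y → Dec (hamming x y ≡ 0)
  equal? y = hamming x y ℕ.≟ 0

  far? : ∀ y → Dec (7 ℕ.≤ hamming x y)
  far? y = 7 ℕ.≤? hamming x y

  separated : ∀ {y} → y ∈ C → hamming x y ≡ 0 ⊎ 3 ℕ.≤ hamming x y
  separated {y} y∈C with x ≟ʷ y
  ... | yes refl = inj₁ (hamming-self x)
  ... | no  x≢y  = inj₂ (minDist x∈C y∈C x≢y)

  pointwise : ∀ {y} → y ∈ C →
              characterSum delsarteDual₈ (x ⊕ y) + + 3 ≤ + 48 * 𝟙 (equal? y) + + 16 * 𝟙 (far? y)
  pointwise {y} y∈C = subst
    (λ d → characterSum delsarteDual₈ (x ⊕ y) + + 3 ≤ + 48 * 𝟙 (d ℕ.≟ 0) + + 16 * 𝟙 (7 ℕ.≤? d))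
    (sym (hamming≡weight-⊕ x y))
    (delsarteDual₈-certificate (x ⊕ y)
      (subst (λ d → d ≡ 0 ⊎ 3 ℕ.≤ d) (hamming≡weight-⊕ x y) (separated y∈C)))

  atMostOneEqual : ∀ {a b} → a ∈ C → b ∈ C → hamming x a ≡ 0 → hamming x b ≡ 0 → a ≡ b
  atMostOneEqual _ _ xa≡0 xb≡0 = trans (sym (hamming≡0⇒≡ {x = x} xa≡0)) (hamming≡0⇒≡ {x = x} xb≡0)

  atMostOneFar : ∀ {a b} → a ∈ C → b ∈ C → 7 ℕ.≤ hamming x a → 7 ℕ.≤ hamming x b → a ≡ b
  atMostOneFar {a} {b} a∈C b∈C xa≥7 xb≥7 with a ≟ʷ b
  ... | yes a≡b = a≡b
  ... | no  a≢b = ⊥-elim (ℕₚ.<⇒≱ (ℕₚ.≤-trans perimeter≥17 (hamming-perimeter x a b)) ℕₚ.≤-refl)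
    where
    perimeter≥17 : 17 ℕ.≤ hamming x a ℕ.+ hamming x b ℕ.+ hamming a b
    perimeter≥17 = ℕₚ.+-mono-≤ (ℕₚ.+-mono-≤ xa≥7 xb≥7) (minDist a∈C b∈C a≢b)

code-length≤21 : ∀ {C : List (Word 8)} → Unique C → HasMinDistance 3 C → length C ℕ.≤ 21
code-length≤21 {C} unique minDist = ℕₚ.≤-pred (ℕₚ.*-cancelʳ-< 3 (length C) 22 (s≤s (ℕₚ.≤-trans
  (delsarte-bound delsarteDual₈ C 3 64 (row-bound₈ unique minDist)) (ℕₚ.n≤1+n 64))))

length≤colours*maxFibre : ∀ {A : Set} {m k} (c : A → Fin m) (L : List A) →
                          (∀ j → length (filter (λ a → c a ≟ j) L) ℕ.≤ k) → length L ℕ.≤ m ℕ.* k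
length≤colours*maxFibre {m = m} {k} c L fibre≤k = ℤₚ.drop‿+≤+ (begin
  + length L                                            ≡⟨ cong +_ (sym (ℕₚ.*-identityʳ (length L))) ⟩
  + (length L ℕ.* 1)                                    ≡⟨ sym (∑-const L 1) ⟩
  ∑[ a ← L ] + 1                                        ≤⟨ ∑-mono-≤ L (λ {a} _ → ∑-𝟙≥1 (c a ≟_) (∈-allFin (c a)) refl) ⟩
  ∑[ a ← L ] ∑[ j ← allFin m ] 𝟙 (c a ≟ j)             ≡⟨ ∑-swap L (allFin m) (λ a j → 𝟙 (c a ≟ j)) ⟩
  ∑[ j ← allFin m ] ∑[ a ← L ] 𝟙 (c a ≟ j)             ≡⟨ ∑-cong (allFin m) (λ j → ∑-𝟙≡length-filter (λ a → c a ≟ j) L) ⟩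
  ∑[ j ← allFin m ] + length (filter (λ a → c a ≟ j) L) ≤⟨ ∑-mono-≤ (allFin m) (λ {j} _ → +≤+ (fibre≤k j)) ⟩
  ∑[ j ← allFin m ] + k                                 ≡⟨ ∑-const (allFin m) k ⟩
  + (length (allFin m) ℕ.* k)                           ≡⟨ cong (λ l → + (l ℕ.* k)) (length-tabulate {n = m} (λ j → j)) ⟩
  + (m ℕ.* k)                                           ∎)
  where open ℤₚ.≤-Reasoning

colourClass-minDistance : ∀ {n m} {c : Word n → Fin m} → ProperColouring (cubePower n 2) m c →
                          ∀ j → HasMinDistance 3 (filter (λ w → c w ≟ j) (words n))
colourClass-minDistance {n} {c = c} proper j {x} {y} x∈class y∈class x≢y with hamming x y ℕ.≤? 2
... | yes close = ⊥-elim (proper x y (x≢y , close) (trans (colour≡j x∈class) (sym (colour≡j y∈class))))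
  where
  colour≡j : ∀ {w} → w ∈ filter (λ w → c w ≟ j) (words n) → c w ≡ j
  colour≡j w∈class = proj₂ (∈-filter⁻ (λ w → c w ≟ j) {xs = words n} w∈class)
... | no  ¬close = ℕₚ.≰⇒> ¬close

no-12-colouring : ∀ m → m ℕ.≤ 12 → ¬ Colourable (cubePower 8 2) m
no-12-colouring m m≤12 (c , proper) = ℕₚ.≤⇒≯ 256≤252 (ℕₚ.m≤m+n 253 3)
  where
  classBound : ∀ j → length (filter (λ w → c w ≟ j) (words 8)) ℕ.≤ 21
  classBound j = code-length≤21 (Unique.filter⁺ (λ w → c w ≟ j) (words-unique 8))
                                (colourClass-minDistance proper j)

  256≤252 : 256 ℕ.≤ 12 ℕ.* 21
  256≤252 = ℕₚ.≤-trans (length≤colours*maxFibre c (words 8) classBound) (ℕₚ.*-monoˡ-≤ 21 m≤12)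

-- Big-endian binary index, reading true as 1.
toFin : ∀ {n} → Word n → Fin (2 ^ n)
toFin []      = Fin.zero
toFin (b ∷ w) = combine {m = 2} (if b then # 1 else # 0) (toFin w)

colouringTable : Vec (Fin 13) 256
colouringTable =
  # 0 ∷ # 10 ∷ # 2 ∷ # 11 ∷ # 5 ∷ # 3 ∷ # 12 ∷ # 1 ∷ # 12 ∷ # 6 ∷ # 1 ∷ # 5 ∷ # 4 ∷ # 8 ∷ # 6 ∷ # 2 ∷
  # 8 ∷ # 4 ∷ # 7 ∷ # 0 ∷ # 2 ∷ # 12 ∷ # 9 ∷ # 6 ∷ # 5 ∷ # 3 ∷ # 4 ∷ # 9 ∷ # 11 ∷ # 7 ∷ # 3 ∷ # 10 ∷
  # 11 ∷ # 9 ∷ # 5 ∷ # 8 ∷ # 8 ∷ # 6 ∷ # 4 ∷ # 0 ∷ # 3 ∷ # 7 ∷ # 10 ∷ # 4 ∷ # 9 ∷ # 10 ∷ # 7 ∷ # 12 ∷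
  # 6 ∷ # 2 ∷ # 12 ∷ # 1 ∷ # 7 ∷ # 5 ∷ # 10 ∷ # 3 ∷ # 0 ∷ # 12 ∷ # 8 ∷ # 6 ∷ # 1 ∷ # 4 ∷ # 2 ∷ # 11 ∷
  # 3 ∷ # 12 ∷ # 10 ∷ # 4 ∷ # 6 ∷ # 7 ∷ # 11 ∷ # 9 ∷ # 9 ∷ # 11 ∷ # 8 ∷ # 7 ∷ # 10 ∷ # 5 ∷ # 0 ∷ # 3 ∷
  # 1 ∷ # 9 ∷ # 6 ∷ # 8 ∷ # 4 ∷ # 11 ∷ # 5 ∷ # 2 ∷ # 7 ∷ # 10 ∷ # 11 ∷ # 12 ∷ # 8 ∷ # 0 ∷ # 1 ∷ # 4 ∷
  # 7 ∷ # 5 ∷ # 9 ∷ # 3 ∷ # 12 ∷ # 4 ∷ # 2 ∷ # 10 ∷ # 4 ∷ # 8 ∷ # 6 ∷ # 0 ∷ # 11 ∷ # 2 ∷ # 5 ∷ # 1 ∷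
  # 10 ∷ # 0 ∷ # 4 ∷ # 11 ∷ # 9 ∷ # 8 ∷ # 0 ∷ # 7 ∷ # 2 ∷ # 1 ∷ # 3 ∷ # 5 ∷ # 6 ∷ # 3 ∷ # 12 ∷ # 9 ∷
  # 9 ∷ # 1 ∷ # 4 ∷ # 3 ∷ # 11 ∷ # 4 ∷ # 7 ∷ # 5 ∷ # 7 ∷ # 0 ∷ # 11 ∷ # 8 ∷ # 2 ∷ # 12 ∷ # 10 ∷ # 9 ∷
  # 10 ∷ # 7 ∷ # 5 ∷ # 12 ∷ # 6 ∷ # 9 ∷ # 8 ∷ # 11 ∷ # 1 ∷ # 11 ∷ # 6 ∷ # 2 ∷ # 0 ∷ # 5 ∷ # 12 ∷ # 1 ∷
  # 2 ∷ # 12 ∷ # 6 ∷ # 10 ∷ # 10 ∷ # 7 ∷ # 9 ∷ # 2 ∷ # 8 ∷ # 5 ∷ # 12 ∷ # 1 ∷ # 6 ∷ # 11 ∷ # 0 ∷ # 3 ∷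
  # 4 ∷ # 8 ∷ # 11 ∷ # 9 ∷ # 12 ∷ # 0 ∷ # 1 ∷ # 4 ∷ # 9 ∷ # 10 ∷ # 7 ∷ # 0 ∷ # 3 ∷ # 2 ∷ # 5 ∷ # 8 ∷
  # 8 ∷ # 2 ∷ # 12 ∷ # 6 ∷ # 0 ∷ # 10 ∷ # 1 ∷ # 8 ∷ # 6 ∷ # 4 ∷ # 5 ∷ # 10 ∷ # 3 ∷ # 1 ∷ # 4 ∷ # 11 ∷
  # 11 ∷ # 5 ∷ # 9 ∷ # 1 ∷ # 7 ∷ # 3 ∷ # 10 ∷ # 0 ∷ # 12 ∷ # 8 ∷ # 0 ∷ # 3 ∷ # 9 ∷ # 6 ∷ # 2 ∷ # 7 ∷
  # 1 ∷ # 11 ∷ # 0 ∷ # 7 ∷ # 5 ∷ # 9 ∷ # 3 ∷ # 12 ∷ # 10 ∷ # 3 ∷ # 2 ∷ # 9 ∷ # 7 ∷ # 0 ∷ # 8 ∷ # 6 ∷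
  # 3 ∷ # 6 ∷ # 8 ∷ # 2 ∷ # 2 ∷ # 1 ∷ # 6 ∷ # 5 ∷ # 5 ∷ # 7 ∷ # 1 ∷ # 4 ∷ # 4 ∷ # 12 ∷ # 11 ∷ # 10 ∷ []

colouring : Word 8 → Fin 13
colouring w = lookup colouringTable (toFin w)

colouring-proper : ProperColouring (cubePower 8 2) 13 colouring
colouring-proper = from-yes (all-words? λ u → all-words? λ v →
  (¬? (u ≟ʷ v) ×-dec hamming u v ℕ.≤? 2) →-dec ¬? (colouring u ≟ colouring v))

mainTheorem1 : ChromaticNumberIs (cubePower 8 2) 13
mainTheorem1 = (colouring , colouring-proper) , λ m m<13 → no-12-colouring m (ℕₚ.≤-pred m<13)
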